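{- Let $(T,L,c,r)$ be a rooted shadow-complete WDTAP instance, let $x$ be a feasible solution to the LP $\min\{c^\top x: Mx\ge\mathbf 1,x\ge 0\}$, let $\sigma$ be a splitting of $L$ and $x'=\mathrm{split}(x,\sigma)$, and let $v\in V\setminus\{r\}$. Then: (1) $x'(L^\downarrow_v)\le x(L^\downarrow_v)$ and $x'(L^\uparrow_v)\le x(L^\uparrow_v)$; (2) if $\sigma=\sigma_{w,L'}$ for some $w\in V$, $L'\subseteq L$ with $w\ne v$ or $L'\cap L^\downarrow_v=\emptyset$, then $x'(L^\downarrow_v)=x(L^\downarrow_v)$; (3) if $\sigma=\sigma_{w,L'}$ for some $w\in V$, $L'\subseteq L$ with $w\ne v$ or $L'\cap L^\uparrow_v=\emptyset$, then $x'(L^\uparrow_v)=x(L^\uparrow_v)$.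
   Context: WDTAP instance: oriented tree $T=(V,A)$, links $L\subseteq V\times V$, costs $c$. For $\ell=(u,v)$, $P_\ell$ is the $u$-$v$ path in the underlying undirected tree traversed from $u$ to $v$; $\overrightarrow{\mathrm{cov}}(\ell)$ is the set of its arcs traversed against their orientation; $M_{a,\ell}=1$ iff $a\in\overrightarrow{\mathrm{cov}}(\ell)$; $x(L'')=\sum_{\ell\in L''}x_\ell$. A shadow of $\ell=(u,v)$ is a link $(u',v')$ with $u',v'$ on $P_\ell$, $u'$ before $v'$ from $u$ to $v$; shadow-complete: every shadow of every $\ell\in L$ is in $L$ with cost at most $c(\ell)$. A splitting of $L$ is a map $\sigma\colon L\to 2^L$ sending $\ell$ to a set of shadows of $\ell$ whose paths partition the arc set of $P_\ell$; $\mathrm{split}(x,\sigma)_{\ell'}=\sum_{\ell:\ell'\in\sigma(\ell)}x_\ell$. For $w\in V$ and $L'\subseteq L$, the splitting $\sigma_{w,L'}$ maps each $\ell=(u,z)\in L'$ with $w$ an inner vertex of $P_\ell$ to $\{(u,w),(w,z)\}$ and every other link $\ell$ to $\{\ell\}$. Rooted: root $r$; $T_v=(U_v,A_v)$ subtree of descendants of $v$. $L^\downarrow_v$ is the set of links $(u,z)$ with $z\in U_v\setminus\{v\}$, $u\notin U_v$; $L^\uparrow_v$ is the set of links $(u,z)$ with $u\in U_v\setminus\{v\}$, $z\notin U_v$.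
   Formalization: The feasible LP solution x and the link costs c take rational values. -}

module Defs where

open import Data.Nat using (ℕ; zero; suc)
open import Data.Fin using (Fin)
open import Data.Fin.Properties using (_≟_)
open import Data.Bool using (Bool; true; false; if_then_else_; not; _∧_; _∨_)
open import Data.List using (List; []; _∷_; _++_; reverse; map; concatMap; foldr; allFin)
open import Data.Bool.ListAction using (any)
open import Data.Product using (_×_; _,_; proj₁; proj₂; Σ; ∃-syntax)
open import Data.Rational using (ℚ; 0ℚ; 1ℚ; _+_; _≤_)
open import Relation.Nullary.Decidable using (⌊_⌋)
open import Relation.Binary.PropositionalEquality using (_≡_)

-- Every vertex v ≠ root has a parent (towards the root in the
-- underlying undirected tree); the tree edge {v , parent v} carries
-- exactly one arc, oriented (v , parent v) if  up v ≡ true  and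
-- (parent v , v) otherwise.  The parent value of the root is irrelevant.

iter : ∀ {A : Set} → (A → A) → ℕ → A → A
iter f zero    a = a
iter f (suc k) a = f (iter f k a)

record RootedOrientedTree (n : ℕ) : Set where
  field
    root        : Fin n
    parent      : Fin n → Fin n
    up          : Fin n → Bool
    -- acyclicity / connectivity: every vertex reaches the root
    reachesRoot : ∀ v → ∃[ k ] iter parent k v ≡ root

open RootedOrientedTree public

Link : ℕ → Set
Link n = Fin n × Fin n

module _ {n : ℕ} where

  infix 4 _==_
  _==_ : Fin n → Fin n → Bool
  a == b = ⌊ a ≟ b ⌋

  elem : Fin n → List (Fin n) → Bool
  elem x xs = any (λ y → x == y) xs

  pairEq : Link n → Link n → Bool
  pairEq (a , b) (c , d) = (a == c) ∧ (b == d)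

  swap : Link n → Link n
  swap (a , b) = (b , a)

  ancs : RootedOrientedTree n → ℕ → Fin n → List (Fin n)
  ancs T zero    u = u ∷ []
  ancs T (suc k) u = if u == root T then u ∷ [] else u ∷ ancs T k (parent T u)

  ancestors : RootedOrientedTree n → Fin n → List (Fin n)
  ancestors T u = ancs T n u

  upPart : List (Fin n) → List (Fin n) → List (Fin n)
  upPart []       ys = []
  upPart (x ∷ xs) ys = if elem x ys then x ∷ [] else x ∷ upPart xs ys

  beforeIn : List (Fin n) → List (Fin n) → List (Fin n)
  beforeIn []       ys = []
  beforeIn (x ∷ xs) ys = if elem x ys then [] else x ∷ beforeIn xs ys

  -- vertex sequence of the u-z path P_ℓ of the underlying tree, from u to z
  pathVerts : RootedOrientedTree n → Link n → List (Fin n)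
  pathVerts T (u , z) =
    upPart (ancestors T u) (ancestors T z) ++ reverse (beforeIn (ancestors T z) (ancestors T u))

  steps : List (Fin n) → List (Link n)
  steps (a ∷ b ∷ xs) = (a , b) ∷ steps (b ∷ xs)
  steps _            = []

  isArc : RootedOrientedTree n → Link n → Bool
  isArc T (t , h) =
    (not (t == root T) ∧ (parent T t == h) ∧ up T t)
    ∨ (not (h == root T) ∧ (parent T h == t) ∧ not (up T h))

  onPath : RootedOrientedTree n → Link n → Link n → Bool
  onPath T ℓ a = any (λ s → pairEq s a ∨ pairEq s (swap a)) (steps (pathVerts T ℓ))

  -- M_{a,ℓ}: arc a = (t , h) is traversed against its orientation (h → t) by P_ℓ
  M : RootedOrientedTree n → Link n → Link n → Bool
  M T a ℓ = any (λ s → pairEq s (swap a)) (steps (pathVerts T ℓ))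

  allLinks : List (Link n)
  allLinks = concatMap (λ i → map (λ j → (i , j)) (allFin n)) (allFin n)

  ΣQ : (Link n → ℚ) → ℚ
  ΣQ f = foldr (λ ℓ s → f ℓ + s) 0ℚ allLinks

  ΣN : (Link n → ℕ) → ℕ
  ΣN f = foldr (λ ℓ s → f ℓ Data.Nat.+ s) 0 allLinks

  xOf : (Link n → Bool) → (Link n → ℚ) → ℚ
  xOf S x = ΣQ (λ ℓ → if S ℓ then x ℓ else 0ℚ)

  Feasible : RootedOrientedTree n → (Link n → Bool) → (Link n → ℚ) → Set
  Feasible T L x =
    (∀ ℓ → L ℓ ≡ true → 0ℚ ≤ x ℓ)
    × (∀ a → isArc T a ≡ true → 1ℚ ≤ ΣQ (λ ℓ → if L ℓ ∧ M T a ℓ then x ℓ else 0ℚ))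

  Shadow : RootedOrientedTree n → Link n → Link n → Set
  Shadow T ℓ (u' , v') =
    Σ (List (Fin n)) λ as → Σ (List (Fin n)) λ bs → Σ (List (Fin n)) λ cs →
      pathVerts T ℓ ≡ as ++ (u' ∷ (bs ++ (v' ∷ cs)))

  ShadowComplete : RootedOrientedTree n → (Link n → Bool) → (Link n → ℚ) → Set
  ShadowComplete T L c =
    ∀ ℓ ℓ' → L ℓ ≡ true → Shadow T ℓ ℓ' → (L ℓ' ≡ true) × (c ℓ' ≤ c ℓ)

  -- σ : L → 2^L is a splitting (only its values on L matter)
  IsSplitting : RootedOrientedTree n → (Link n → Bool) → (Link n → Link n → Bool) → Set
  IsSplitting T L σ =
    ∀ ℓ → L ℓ ≡ true →
      (∀ ℓ' → σ ℓ ℓ' ≡ true → (L ℓ' ≡ true) × Shadow T ℓ ℓ')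
      × (∀ a → isArc T a ≡ true →
           ΣN (λ ℓ' → if σ ℓ ℓ' ∧ onPath T ℓ' a then 1 else 0)
             ≡ (if onPath T ℓ a then 1 else 0))

  split : (Link n → Bool) → (Link n → ℚ) → (Link n → Link n → Bool) → Link n → ℚ
  split L x σ ℓ' = ΣQ (λ ℓ → if L ℓ ∧ σ ℓ ℓ' then x ℓ else 0ℚ)

  inner : RootedOrientedTree n → Fin n → Link n → Bool
  inner T w (u , z) = elem w (pathVerts T (u , z)) ∧ not (w == u) ∧ not (w == z)

  σsplit : RootedOrientedTree n → Fin n → (Link n → Bool) → Link n → Link n → Bool
  σsplit T w L' (u , z) ℓ' =
    if L' (u , z) ∧ inner T w (u , z)
    then pairEq ℓ' (u , w) ∨ pairEq ℓ' (w , z)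
    else pairEq ℓ' (u , z)

  -- w ∈ U_v  (w is a descendant of v, v itself included)
  inU : RootedOrientedTree n → Fin n → Fin n → Bool
  inU T v w = elem v (ancestors T w)

  Ldown : RootedOrientedTree n → (Link n → Bool) → Fin n → Link n → Bool
  Ldown T L v (u , z) = L (u , z) ∧ inU T v z ∧ not (z == v) ∧ not (inU T v u)

  Lup : RootedOrientedTree n → (Link n → Bool) → Fin n → Link n → Bool
  Lup T L v (u , z) = L (u , z) ∧ inU T v u ∧ not (u == v) ∧ not (inU T v z)

{-# OPTIONS --safe #-}
module Submission where

-- Write x′ = split(x , σ).  For a set D ⊆ L of links whose tree paths all use one arc a,
-- exchanging the two sums gives x′(D) = Σ_{ℓ ∈ L} x_ℓ · #{pieces of ℓ lying in D}, and the
-- count is at most 1 because the pieces of ℓ partition the arcs of P_ℓ.  For D = L↓_v or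
-- L↑_v, with a the arc between v and its parent, D is moreover closed under passing from a
-- shadow to its link: a tree path is a simple walk, it can cross the boundary of U_v only
-- through v, and it visits v once, so a shadow entering (leaving) U_v forces the link itself
-- to enter (leave) U_v.  Hence every term is at most x_ℓ [ℓ ∈ D], using only x ≥ 0 from
-- feasibility, with equality as soon as each
-- ℓ ∈ D has a piece in D.  For σ_{w,L′} with w ≠ v one of the two halves at w of a link of D is
-- again in D.

open import Defs
open import Data.Nat using (ℕ)
open import Data.Fin using (Fin)
open import Data.Bool using (Bool; true; false)
open import Data.Product using (_×_)
open import Data.Sum using (_⊎_)
open import Data.Rational using (ℚ; _≤_)
open import Relation.Binary.PropositionalEquality using (_≡_; _≢_)

open import Algebra.Bundles using (CommutativeMonoid)
open import Data.Bool using (if_then_else_; _∧_; _∨_)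
import Data.Bool.Properties as Bool
open import Data.Bool.ListAction using (any)
open import Data.Fin using (toℕ)
open import Data.Fin.Properties using (_≟_; pigeonhole; toℕ≤pred[n])
open import Data.List using (List; []; _∷_; _++_; [_]; reverse; reverseAcc; foldr; map; allFin)
open import Data.List.Properties
  using (reverse-++; unfold-reverse; ∷-injectiveˡ; ∷-injectiveʳ; ++-conicalˡ; ++-conicalʳ
        ; ++-identityˡ-unique; ++-assoc)
open import Data.List.Membership.Propositional using (_∈_; _∉_; find; lose)
open import Data.List.Membership.Propositional.Properties
  using (∈-∃++; ∈-++⁺ˡ; ∈-++⁺ʳ; ∈-++⁻; ∈-map⁺; ∈-concatMap⁺; ∈-allFin)
open import Data.List.Relation.Binary.Disjoint.Propositional using (Disjoint)
open import Data.List.Relation.Binary.Permutation.Propositional using (↭-sym; ↭⇒↭ₛ)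
open import Data.List.Relation.Binary.Permutation.Propositional.Properties using (↭-reverse)
open import Data.List.Relation.Unary.All as All using (All; []; _∷_)
open import Data.List.Relation.Unary.All.Properties using (++⁻ˡ; ¬Any⇒All¬)
open import Data.List.Relation.Unary.AllPairs using ([]; _∷_)
open import Data.List.Relation.Unary.Any as Any using (Any; here; there)
open import Data.List.Relation.Unary.Any.Properties using (any⁺; any⁻; reverse⁻)
open import Data.List.Relation.Unary.Linked as Linked using (Linked; []; [-]; _∷_)
open import Data.List.Relation.Unary.Unique.Propositional using (Unique)
import Data.List.Relation.Unary.Unique.Propositional.Properties as Unique
open import Data.Nat as ℕ using (zero; suc; z≤n; s≤s)
import Data.Nat.Properties as ℕ
open import Data.Nat.Induction using (<-rec)
import Data.Product as Product
open import Data.Product using (_,_; proj₁; proj₂; ∃-syntax)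
open import Data.Rational using (0ℚ; _+_)
import Data.Rational.Properties as ℚ
open import Data.Sum using (inj₁; inj₂)
open import Function using (_∘_; Equivalence)
open import Relation.Binary using (Symmetric)
open import Relation.Binary.PropositionalEquality
  using (refl; sym; trans; cong; cong₂; subst; subst₂; setoid; module ≡-Reasoning)
open import Relation.Nullary using (yes; no; contradiction)
open import Relation.Nullary.Decidable using (toWitness; fromWitness; fromWitnessFalse; decidable-stable)

open import Algebra.Properties.CommutativeSemigroup
  (CommutativeMonoid.commutativeSemigroup ℚ.+-0-commutativeMonoid) using (interchange)

∧-≡true⁻ : ∀ {a b} → (a ∧ b) ≡ true → a ≡ true × b ≡ true
∧-≡true⁻ {true} b≡true = refl , b≡true

∧-≡true⁺ : ∀ {a b} → a ≡ true → b ≡ true → (a ∧ b) ≡ true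
∧-≡true⁺ refl refl = refl

false-true-≢ : ∀ {a b : Bool} → a ≡ false → b ≡ true → a ≢ b
false-true-≢ refl refl ()

if-zero : ∀ b → (if b then 0ℚ else 0ℚ) ≡ 0ℚ
if-zero true  = refl
if-zero false = refl

if-if : ∀ a b (q : ℚ) → (if a then (if b then q else 0ℚ) else 0ℚ) ≡ (if b ∧ a then q else 0ℚ)
if-if true  true  q = refl
if-if true  false q = refl
if-if false true  q = refl
if-if false false q = refl

module _ {X : Set} where

  any-≡true⁺ : ∀ (P : X → Bool) {xs} → Any (λ y → P y ≡ true) xs → any P xs ≡ true
  any-≡true⁺ P some = Equivalence.to Bool.T-≡ (any⁺ P (Any.map (Equivalence.from Bool.T-≡) some))

  any-≡true⁻ : ∀ (P : X → Bool) xs → any P xs ≡ true → ∃[ y ] y ∈ xs × P y ≡ true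
  any-≡true⁻ P xs h with y , y∈xs , Py ← find (any⁻ P xs (Equivalence.from Bool.T-≡ h)) =
    y , y∈xs , Equivalence.to Bool.T-≡ Py

module _ {n : ℕ} where

  ==-refl : (a : Fin n) → (a == a) ≡ true
  ==-refl a = Equivalence.to Bool.T-≡ (fromWitness refl)

  ==⇒≡ : {a b : Fin n} → (a == b) ≡ true → a ≡ b
  ==⇒≡ e = toWitness (Equivalence.from Bool.T-≡ e)

  ≢⇒==-false : {a b : Fin n} → a ≢ b → (a == b) ≡ false
  ≢⇒==-false a≢b = Equivalence.to Bool.T-not-≡ (fromWitnessFalse a≢b)

  pairEq-refl : (ℓ : Link n) → pairEq ℓ ℓ ≡ true
  pairEq-refl (a , b) rewrite ==-refl a | ==-refl b = refl

  ∈⇒elem : ∀ {x : Fin n} {ys} → x ∈ ys → elem x ys ≡ true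
  ∈⇒elem {x} x∈ys = any-≡true⁺ (x ==_) (Any.map (λ { refl → ==-refl x }) x∈ys)

  elem⇒∈ : ∀ {x : Fin n} ys → elem x ys ≡ true → x ∈ ys
  elem⇒∈ {x} ys h with y , y∈ys , x=y ← any-≡true⁻ (x ==_) ys h = subst (_∈ ys) (sym (==⇒≡ x=y)) y∈ys

  ∉⇒elem-false : ∀ {x : Fin n} {ys} → x ∉ ys → elem x ys ≡ false
  ∉⇒elem-false {x} {ys} x∉ys with elem x ys in e
  ... | true  = contradiction (elem⇒∈ ys e) x∉ys
  ... | false = refl

  ∈-allLinks : (ℓ : Link n) → ℓ ∈ allLinks
  ∈-allLinks (i , j) =
    ∈-concatMap⁺ (λ i → map (i ,_) (allFin n)) (lose (∈-allFin i) (∈-map⁺ (i ,_) (∈-allFin j)))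

module _ {X : Set} where

  Σℚ : List X → (X → ℚ) → ℚ
  Σℚ xs f = foldr (λ y s → f y + s) 0ℚ xs

  count : (X → Bool) → List X → ℕ
  count P xs = foldr (λ y s → (if P y then 1 else 0) ℕ.+ s) 0 xs

  Σℚ-cong : ∀ xs {f g : X → ℚ} → (∀ y → f y ≡ g y) → Σℚ xs f ≡ Σℚ xs g
  Σℚ-cong []       f≗g = refl
  Σℚ-cong (y ∷ xs) f≗g = cong₂ _+_ (f≗g y) (Σℚ-cong xs f≗g)

  Σℚ-mono : ∀ xs {f g : X → ℚ} → (∀ y → f y ≤ g y) → Σℚ xs f ≤ Σℚ xs g
  Σℚ-mono []       f≤g = ℚ.≤-refl
  Σℚ-mono (y ∷ xs) f≤g = ℚ.+-mono-≤ (f≤g y) (Σℚ-mono xs f≤g)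

  Σℚ-zero : ∀ xs → Σℚ xs (λ _ → 0ℚ) ≡ 0ℚ
  Σℚ-zero []       = refl
  Σℚ-zero (y ∷ xs) = trans (ℚ.+-identityˡ _) (Σℚ-zero xs)

  Σℚ-+ : ∀ xs (f g : X → ℚ) → Σℚ xs (λ y → f y + g y) ≡ Σℚ xs f + Σℚ xs g
  Σℚ-+ []       f g = sym (ℚ.+-identityˡ 0ℚ)
  Σℚ-+ (y ∷ xs) f g =
    trans (cong (f y + g y +_) (Σℚ-+ xs f g)) (interchange (f y) (g y) (Σℚ xs f) (Σℚ xs g))

  if-Σℚ : ∀ b xs (f : X → ℚ) → (if b then Σℚ xs f else 0ℚ) ≡ Σℚ xs (λ y → if b then f y else 0ℚ)
  if-Σℚ true  xs f = refl
  if-Σℚ false xs f = sym (Σℚ-zero xs)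

  count-mono : ∀ xs {P Q : X → Bool} → (∀ y → P y ≡ true → Q y ≡ true) → count P xs ℕ.≤ count Q xs
  count-mono []       P⇒Q = z≤n
  count-mono (y ∷ xs) {P} {Q} P⇒Q = ℕ.+-mono-≤ (indicator-mono (P y) (Q y) (P⇒Q y)) (count-mono xs P⇒Q)
    where
      indicator-mono : ∀ a b → (a ≡ true → b ≡ true) → (if a then 1 else 0) ℕ.≤ (if b then 1 else 0)
      indicator-mono false b a⇒b = z≤n
      indicator-mono true  b a⇒b rewrite a⇒b refl = ℕ.≤-refl

  count≡0⇒any≡false : ∀ (P : X → Bool) xs → count P xs ≡ 0 → any P xs ≡ false
  count≡0⇒any≡false P []       _ = refl
  count≡0⇒any≡false P (y ∷ xs) c≡0 with P y
  count≡0⇒any≡false P (y ∷ xs) ()  | true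
  count≡0⇒any≡false P (y ∷ xs) c≡0 | false = count≡0⇒any≡false P xs c≡0

  Σℚ-indicator : ∀ xs (P : X → Bool) q → count P xs ℕ.≤ 1 →
                 Σℚ xs (λ y → if P y then q else 0ℚ) ≡ (if any P xs then q else 0ℚ)
  Σℚ-indicator []       P q _ = refl
  Σℚ-indicator (y ∷ xs) P q c≤1 with P y
  ... | false = trans (ℚ.+-identityˡ _) (Σℚ-indicator xs P q c≤1)
  ... | true  = begin
      q + Σℚ xs (λ y → if P y then q else 0ℚ)  ≡⟨ cong (q +_) (Σℚ-indicator xs P q (ℕ.m≤n⇒m≤1+n rest≤0)) ⟩
      q + (if any P xs then q else 0ℚ)         ≡⟨ cong (λ b → q + (if b then q else 0ℚ)) rest-empty ⟩
      q + 0ℚ                                   ≡⟨ ℚ.+-identityʳ q ⟩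
      q                                        ∎
    where
      open ≡-Reasoning
      rest≤0 : count P xs ℕ.≤ 0
      rest≤0 = ℕ.s≤s⁻¹ c≤1
      rest-empty : any P xs ≡ false
      rest-empty = count≡0⇒any≡false P xs (ℕ.n≤0⇒n≡0 rest≤0)

Σℚ-swap : ∀ {X Y : Set} xs ys (f : X → Y → ℚ) →
          Σℚ xs (λ a → Σℚ ys (f a)) ≡ Σℚ ys (λ b → Σℚ xs (λ a → f a b))
Σℚ-swap []       ys f = sym (Σℚ-zero ys)
Σℚ-swap (x ∷ xs) ys f = trans (cong (Σℚ ys (f x) +_) (Σℚ-swap xs ys f)) (sym (Σℚ-+ ys (f x) _))

record ShadowClosedCut {n : ℕ} (T : RootedOrientedTree n) (L D : Link n → Bool) : Set where
  field
    arc           : Link n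
    arc-isArc     : isArc T arc ≡ true
    ⊆L            : ∀ ℓ → D ℓ ≡ true → L ℓ ≡ true
    crosses       : ∀ ℓ → D ℓ ≡ true → onPath T ℓ arc ≡ true
    shadow-closed : ∀ ℓ ℓ′ → L ℓ ≡ true → Shadow T ℓ ℓ′ → D ℓ′ ≡ true → D ℓ ≡ true

module SplitMass {n : ℕ} {T : RootedOrientedTree n} {L D : Link n → Bool} {σ : Link n → Link n → Bool}
                 (spl : IsSplitting T L σ) (cut : ShadowClosedCut T L D) (x : Link n → ℚ) where

  open ShadowClosedCut cut

  hasPiece : Link n → Bool
  hasPiece ℓ = any (λ ℓ′ → σ ℓ ℓ′ ∧ D ℓ′) allLinks

  at-most-one-piece : ∀ ℓ → L ℓ ≡ true → count (λ ℓ′ → σ ℓ ℓ′ ∧ D ℓ′) allLinks ℕ.≤ 1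
  at-most-one-piece ℓ Lℓ = begin
    count (λ ℓ′ → σ ℓ ℓ′ ∧ D ℓ′) allLinks             ≤⟨ count-mono allLinks piece-crosses ⟩
    count (λ ℓ′ → σ ℓ ℓ′ ∧ onPath T ℓ′ arc) allLinks  ≡⟨ proj₂ (spl ℓ Lℓ) arc arc-isArc ⟩
    (if onPath T ℓ arc then 1 else 0)                  ≤⟨ indicator≤1 (onPath T ℓ arc) ⟩
    1                                                  ∎
    where
      open ℕ.≤-Reasoning
      piece-crosses : ∀ ℓ′ → (σ ℓ ℓ′ ∧ D ℓ′) ≡ true → (σ ℓ ℓ′ ∧ onPath T ℓ′ arc) ≡ true
      piece-crosses ℓ′ h with σ ℓ ℓ′
      piece-crosses ℓ′ h  | true  = crosses ℓ′ h
      piece-crosses ℓ′ () | false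
      indicator≤1 : ∀ b → (if b then 1 else 0) ℕ.≤ 1
      indicator≤1 true  = ℕ.≤-refl
      indicator≤1 false = z≤n

  share : Link n → Link n → ℚ
  share ℓ′ ℓ = if D ℓ′ then (if L ℓ ∧ σ ℓ ℓ′ then x ℓ else 0ℚ) else 0ℚ

  shares-of : ∀ ℓ → Σℚ allLinks (λ ℓ′ → share ℓ′ ℓ) ≡ (if L ℓ ∧ hasPiece ℓ then x ℓ else 0ℚ)
  shares-of ℓ with L ℓ in Lℓ
  ... | false = trans (Σℚ-cong allLinks (λ ℓ′ → if-zero (D ℓ′))) (Σℚ-zero (allLinks {n}))
  ... | true  = trans (Σℚ-cong allLinks (λ ℓ′ → if-if (D ℓ′) (σ ℓ ℓ′) (x ℓ)))
                      (Σℚ-indicator allLinks (λ ℓ′ → σ ℓ ℓ′ ∧ D ℓ′) (x ℓ) (at-most-one-piece ℓ Lℓ))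

  split-mass : xOf D (split L x σ) ≡ Σℚ allLinks (λ ℓ → if L ℓ ∧ hasPiece ℓ then x ℓ else 0ℚ)
  split-mass = begin
    xOf D (split L x σ)
      ≡⟨ Σℚ-cong allLinks (λ ℓ′ → if-Σℚ (D ℓ′) (allLinks {n}) _) ⟩
    Σℚ allLinks (λ ℓ′ → Σℚ allLinks (share ℓ′))
      ≡⟨ Σℚ-swap allLinks allLinks share ⟩
    Σℚ allLinks (λ ℓ → Σℚ allLinks (λ ℓ′ → share ℓ′ ℓ))
      ≡⟨ Σℚ-cong allLinks shares-of ⟩
    Σℚ allLinks (λ ℓ → if L ℓ ∧ hasPiece ℓ then x ℓ else 0ℚ)
      ∎
    where open ≡-Reasoning

  hasPiece⇒D : ∀ ℓ → (L ℓ ∧ hasPiece ℓ) ≡ true → D ℓ ≡ true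
  hasPiece⇒D ℓ h
    with Lℓ , has ← ∧-≡true⁻ h
    with ℓ′ , _ , piece ← any-≡true⁻ _ allLinks has
    with σℓℓ′ , Dℓ′ ← ∧-≡true⁻ piece
    = shadow-closed ℓ ℓ′ Lℓ (proj₂ (proj₁ (spl ℓ Lℓ) ℓ′ σℓℓ′)) Dℓ′

  split-mass-≤ : (∀ ℓ → L ℓ ≡ true → 0ℚ ≤ x ℓ) → xOf D (split L x σ) ≤ xOf D x
  split-mass-≤ x≥0 = subst (_≤ xOf D x) (sym split-mass) (Σℚ-mono allLinks term≤)
    where
      term≤ : ∀ ℓ → (if L ℓ ∧ hasPiece ℓ then x ℓ else 0ℚ) ≤ (if D ℓ then x ℓ else 0ℚ)
      term≤ ℓ with L ℓ ∧ hasPiece ℓ in h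
      ... | true rewrite hasPiece⇒D ℓ h = ℚ.≤-refl
      ... | false with D ℓ in Dℓ
      ...   | true  = x≥0 ℓ (⊆L ℓ Dℓ)
      ...   | false = ℚ.≤-refl

  split-mass-≡ : (∀ ℓ → D ℓ ≡ true → ∃[ ℓ′ ] σ ℓ ℓ′ ≡ true × D ℓ′ ≡ true) → xOf D (split L x σ) ≡ xOf D x
  split-mass-≡ pieces =
    trans split-mass (Σℚ-cong allLinks (λ ℓ → cong (λ b → if b then x ℓ else 0ℚ) (hasPiece≡D ℓ)))
    where
      hasPiece≡D : ∀ ℓ → (L ℓ ∧ hasPiece ℓ) ≡ D ℓ
      hasPiece≡D ℓ with D ℓ in Dℓ
      ... | true  = let ℓ′ , σℓℓ′ , Dℓ′ = pieces ℓ Dℓ in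
                    ∧-≡true⁺ (⊆L ℓ Dℓ) (any-≡true⁺ _ (lose (∈-allLinks ℓ′) (∧-≡true⁺ σℓℓ′ Dℓ′)))
      ... | false with L ℓ ∧ hasPiece ℓ in h
      ...   | true  with () ← trans (sym (hasPiece⇒D ℓ h)) Dℓ
      ...   | false = refl

module _ {A : Set} where

  ++-∷-head : ∀ (xs : List A) {y ys u t} → xs ++ y ∷ ys ≡ u ∷ t → ∃[ t′ ] xs ++ [ y ] ≡ u ∷ t′
  ++-∷-head []           refl = [] , refl
  ++-∷-head (x ∷ xs) {y} refl = xs ++ [ y ] , refl

  ++-∷-last : ∀ (i xs : List A) {z y ys} → i ++ [ z ] ≡ xs ++ y ∷ ys → z ∈ y ∷ ys
  ++-∷-last i       []       e = subst (_ ∈_) e (∈-++⁺ʳ i (here refl))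
  ++-∷-last []      (x ∷ xs) e with () ← ++-conicalʳ xs _ (sym (∷-injectiveʳ e))
  ++-∷-last (_ ∷ i) (_ ∷ xs) e = ++-∷-last i xs (∷-injectiveʳ e)

  Unique-++⁻ˡ : ∀ (xs : List A) {ys} → Unique (xs ++ ys) → Unique xs
  Unique-++⁻ˡ []       _          = []
  Unique-++⁻ˡ (x ∷ xs) (x∉ ∷ xs!) = ++⁻ˡ xs x∉ ∷ Unique-++⁻ˡ xs xs!

  Unique-++⇒∉ : ∀ (xs : List A) {ys x} → Unique (xs ++ ys) → x ∈ xs → x ∉ ys
  Unique-++⇒∉ (x ∷ xs) (x∉ ∷ _)  (here refl) x∈ys = All.lookup x∉ (∈-++⁺ʳ xs x∈ys) refl
  Unique-++⇒∉ (_ ∷ xs) (_ ∷ xs!) (there x∈)  = Unique-++⇒∉ xs xs! x∈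

  Unique-reverse : ∀ {xs : List A} → Unique xs → Unique (reverse xs)
  Unique-reverse {xs} = Unique-resp-↭ (↭⇒↭ₛ (↭-sym (↭-reverse xs)))
    where
      open import Data.List.Relation.Binary.Permutation.Setoid.Properties (setoid A) using (Unique-resp-↭)

  module _ {R : A → A → Set} where

    Linked-++⁻ˡ : ∀ xs {ys} → Linked R (xs ++ ys) → Linked R xs
    Linked-++⁻ˡ []           _          = []
    Linked-++⁻ˡ (x ∷ [])     _          = [-]
    Linked-++⁻ˡ (x ∷ y ∷ xs) (Rxy ∷ lk) = Rxy ∷ Linked-++⁻ˡ (y ∷ xs) lk

    Linked-++⁻ʳ : ∀ xs {ys} → Linked R (xs ++ ys) → Linked R ys
    Linked-++⁻ʳ []       lk = lk
    Linked-++⁻ʳ (x ∷ xs) lk = Linked-++⁻ʳ xs (Linked.tail lk)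

    Linked-join : ∀ xs {m ys} → Linked R (xs ++ [ m ]) → Linked R (m ∷ ys) → Linked R (xs ++ m ∷ ys)
    Linked-join []           _           lk  = lk
    Linked-join (x ∷ [])     (Rxm ∷ [-]) lk  = Rxm ∷ lk
    Linked-join (x ∷ y ∷ xs) (Rxy ∷ lk₁) lk₂ = Rxy ∷ Linked-join (y ∷ xs) lk₁ lk₂

    Linked-reverse : Symmetric R → ∀ {xs} → Linked R xs → Linked R (reverse xs)
    Linked-reverse sym-R {[]}     [] = []
    Linked-reverse sym-R {x ∷ xs} lk = reverseAcc⁺ xs [] lk [-]
      where
        reverseAcc⁺ : ∀ {x} xs acc → Linked R (x ∷ xs) → Linked R (x ∷ acc) →
                      Linked R (reverseAcc (x ∷ acc) xs)
        reverseAcc⁺ []       acc _          lk-acc = lk-acc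
        reverseAcc⁺ (y ∷ ys) acc (Rxy ∷ lk) lk-acc = reverseAcc⁺ ys (_ ∷ acc) lk (sym-R Rxy ∷ lk-acc)

module _ {n : ℕ} where

  ∈-steps⁻ : ∀ (w : List (Fin n)) {a b} → (a , b) ∈ steps w → a ∈ w × b ∈ w
  ∈-steps⁻ (x ∷ y ∷ w) (here refl) = here refl , there (here refl)
  ∈-steps⁻ (x ∷ y ∷ w) (there st)  = Product.map there there (∈-steps⁻ (y ∷ w) st)

  SwitchingStep : (Fin n → Fin n → Set) → (Fin n → Bool) → Link n → Set
  SwitchingStep R s (a , b) = R a b × s a ≢ s b

  switching-step-from : ∀ {R} (s : Fin n → Bool) {x xs y} → Linked R (x ∷ xs) → y ∈ x ∷ xs → s x ≢ s y →
                        Any (SwitchingStep R s) (steps (x ∷ xs))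
  switching-step-from s _ (here refl) sx≢sy = contradiction refl sx≢sy
  switching-step-from s {x} (_∷_ {y = b} Rxb lk) (there y∈) sx≢sy with s x Bool.≟ s b
  ... | no  x≁b = here (Rxb , x≁b)
  ... | yes x~b = there (switching-step-from s lk y∈ (sx≢sy ∘ trans x~b))

  switching-step : ∀ {R} (s : Fin n → Bool) {w x y} → Linked R w → x ∈ w → y ∈ w → s x ≢ s y →
                   Any (SwitchingStep R s) (steps w)
  switching-step s {h ∷ _} {x} lk x∈ y∈ sx≢sy with s h Bool.≟ s x
  ... | yes h~x = switching-step-from s lk y∈ (sx≢sy ∘ trans (sym h~x))
  ... | no  h≁x = switching-step-from s lk x∈ h≁x

module _ {A : Set} (f : A → A) where

  iter-suc : ∀ k x → iter f k (f x) ≡ iter f (suc k) x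
  iter-suc zero    x = refl
  iter-suc (suc k) x = cong f (iter-suc k x)

  iter-+ : ∀ i j x → iter f (i ℕ.+ j) x ≡ iter f i (iter f j x)
  iter-+ zero    j x = refl
  iter-+ (suc i) j x = cong f (iter-+ i j x)

  iter-shortcut : ∀ {i j k} x → iter f i x ≡ iter f j x → j ℕ.≤ k → iter f (k ℕ.∸ j ℕ.+ i) x ≡ iter f k x
  iter-shortcut {i} {j} {k} x same j≤k = begin
    iter f (k ℕ.∸ j ℕ.+ i) x        ≡⟨ iter-+ (k ℕ.∸ j) i x ⟩
    iter f (k ℕ.∸ j) (iter f i x)   ≡⟨ cong (iter f (k ℕ.∸ j)) same ⟩
    iter f (k ℕ.∸ j) (iter f j x)   ≡⟨ sym (iter-+ (k ℕ.∸ j) j x) ⟩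
    iter f (k ℕ.∸ j ℕ.+ j) x        ≡⟨ cong (λ m → iter f m x) (ℕ.m∸n+n≡m j≤k) ⟩
    iter f k x                      ∎
    where open ≡-Reasoning

data Adjacent {n : ℕ} (T : RootedOrientedTree n) : Fin n → Fin n → Set where
  toParent   : ∀ {a} → a ≢ root T → Adjacent T a (parent T a)
  fromParent : ∀ {a} → a ≢ root T → Adjacent T (parent T a) a

Adjacent-sym : ∀ {n} {T : RootedOrientedTree n} → Symmetric (Adjacent T)
Adjacent-sym (toParent a≢r)   = fromParent a≢r
Adjacent-sym (fromParent a≢r) = toParent a≢r

module _ {n : ℕ} (T : RootedOrientedTree n) where

  open RootedOrientedTree T using () renaming (root to r; parent to p)

  -- The fuel n of  ancestors  suffices: by pigeonhole, a visit of the root after more than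
  -- n steps can be made earlier.
  reaches-root-within : ∀ x → ∃[ k ] k ℕ.≤ n × iter p k x ≡ r
  reaches-root-within x = <-rec Goal shorten (proj₁ (reachesRoot T x)) (proj₂ (reachesRoot T x))
    where
      Goal : ℕ → Set
      Goal k = iter p k x ≡ r → ∃[ j ] j ℕ.≤ n × iter p j x ≡ r
      shorten : ∀ k → (∀ {j} → j ℕ.< k → Goal j) → Goal k
      shorten k earlier reach with k ℕ.≤? n
      ... | yes k≤n = k , k≤n , reach
      ... | no  k≰n with i , j , i<j , same ← pigeonhole (ℕ.n<1+n n) (λ i → iter p (toℕ i) x) =
        earlier (subst (k ℕ.∸ toℕ j ℕ.+ toℕ i ℕ.<_) (ℕ.m∸n+n≡m j≤k) (ℕ.+-monoʳ-< (k ℕ.∸ toℕ j) i<j))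
                (trans (iter-shortcut p x same j≤k) reach)
        where
          j≤k : toℕ j ℕ.≤ k
          j≤k = ℕ.≤-trans (toℕ≤pred[n] j) (ℕ.<⇒≤ (ℕ.≰⇒> k≰n))

  ancs-head : ∀ k x → ∃[ t ] ancs T k x ≡ x ∷ t
  ancs-head zero    x = [] , refl
  ancs-head (suc k) x with x == r
  ... | true  = [] , refl
  ... | false = ancs T k (p x) , refl

  ancs-root : ∀ k → ancs T k r ≡ [ r ]
  ancs-root zero    = refl
  ancs-root (suc k) rewrite ==-refl r = refl

  ancs-linked : ∀ k x → Linked (Adjacent T) (ancs T k x)
  ancs-linked zero    x = [-]
  ancs-linked (suc k) x with x ≟ r
  ... | yes _   = [-]
  ... | no  x≢r with ancs T k (p x) | ancs-head k (p x) | ancs-linked k (p x)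
  ...   | _ | _ , refl | lk = toParent x≢r ∷ lk

  iter-∈-ancs : ∀ k j x → j ℕ.≤ k → iter p j x ≡ r → r ∈ ancs T k x
  iter-∈-ancs k       zero    x _ refl = subst (r ∈_) (sym (proj₂ (ancs-head k r))) (here refl)
  iter-∈-ancs (suc k) (suc j) x (s≤s j≤k) reach with x ≟ r
  ... | yes x≡r = here (sym x≡r)
  ... | no  _   = there (iter-∈-ancs k j (p x) j≤k (trans (iter-suc p j x) reach))

  ancs-stable : ∀ k x → r ∈ ancs T k x → ancs T (suc k) x ≡ ancs T k x
  ancs-stable zero    x (here refl) = ancs-root 1
  ancs-stable (suc k) x r∈ with x ≟ r
  ancs-stable (suc k) x r∈         | yes _   = refl
  ancs-stable (suc k) x (here r≡x) | no  x≢r = contradiction (sym r≡x) x≢r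
  ancs-stable (suc k) x (there r∈) | no  x≢r = cong (x ∷_) (ancs-stable k (p x) r∈)

  ancs-step : ∀ k {x} → x ≢ r → r ∈ ancs T k x → ancs T k x ≡ x ∷ ancs T k (p x)
  ancs-step zero        x≢r (here r≡x) = contradiction (sym r≡x) x≢r
  ancs-step (suc k) {x} x≢r r∈ with x ≟ r
  ancs-step (suc k) {x} x≢r r∈         | yes x≡r = contradiction x≡r x≢r
  ancs-step (suc k) {x} x≢r (here r≡x) | no  _   = contradiction (sym r≡x) x≢r
  ancs-step (suc k) {x} x≢r (there r∈) | no  _   = cong (x ∷_) (sym (ancs-stable k (p x) r∈))

  root∈ancestors : ∀ x → r ∈ ancestors T x
  root∈ancestors x with k , k≤n , reach ← reaches-root-within x = iter-∈-ancs n k x k≤n reach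

  ancestors-root : ancestors T r ≡ [ r ]
  ancestors-root = ancs-root n

  ancestors-step : ∀ {x} → x ≢ r → ancestors T x ≡ x ∷ ancestors T (p x)
  ancestors-step x≢r = ancs-step n x≢r (root∈ancestors _)

  ancestors-head : ∀ x → ∃[ t ] ancestors T x ≡ x ∷ t
  ancestors-head = ancs-head n

  ancestors-linked : ∀ x → Linked (Adjacent T) (ancestors T x)
  ancestors-linked = ancs-linked n

  ancestors-suffix : ∀ pre {x y rest} → ancestors T x ≡ pre ++ y ∷ rest → ancestors T y ≡ y ∷ rest
  ancestors-suffix [] {x} e
    with t , e′ ← ancestors-head x
    with refl ← ∷-injectiveˡ (trans (sym e′) e) = e
  ancestors-suffix (q ∷ pre) {x} e with x ≟ r
  ... | yes refl with () ← ++-conicalʳ pre _ (sym (∷-injectiveʳ (trans (sym ancestors-root) e)))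
  ... | no  x≢r  = ancestors-suffix pre (∷-injectiveʳ (trans (sym (ancestors-step x≢r)) e))

  ∈-ancestors⇒suffix : ∀ {x y} → y ∈ ancestors T x → ∃[ pre ] ancestors T x ≡ pre ++ ancestors T y
  ∈-ancestors⇒suffix y∈ with pre , rest , e ← ∈-∃++ y∈ =
    pre , trans e (cong (pre ++_) (sym (ancestors-suffix pre e)))

  ancestors-parent∌ : ∀ {x} → x ≢ r → x ∉ ancestors T (p x)
  ancestors-parent∌ {x} x≢r x∈
    with pre , e ← ∈-ancestors⇒suffix x∈
    with () ← ++-conicalʳ pre _ (++-identityˡ-unique (pre ++ [ x ])
                (trans e (trans (cong (pre ++_) (ancestors-step x≢r)) (sym (++-assoc pre [ x ] _)))))

  ancestors-unique : ∀ x → Unique (ancestors T x)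
  ancestors-unique x = unique-list _ refl
    where
      unique-list : ∀ xs {x} → ancestors T x ≡ xs → Unique xs
      unique-list []       _ = []
      unique-list (y ∷ ys) {x} e with x ≟ r
      ... | yes refl = subst Unique (trans (sym ancestors-root) e) ([] ∷ [])
      ... | no  x≢r  with eq ← trans (sym (ancestors-step x≢r)) e =
        ¬Any⇒All¬ ys (subst₂ _∉_ (∷-injectiveˡ eq) (∷-injectiveʳ eq) (ancestors-parent∌ x≢r))
        ∷ unique-list ys (∷-injectiveʳ eq)

  ancestors-antisym : ∀ {x y} → y ∈ ancestors T x → x ∈ ancestors T y → x ≡ y
  ancestors-antisym {x} {y} y∈ x∈
    with pre , ex ← ∈-ancestors⇒suffix y∈ | pre′ , ey ← ∈-ancestors⇒suffix x∈
    with refl ← ++-conicalˡ pre pre′ (++-identityˡ-unique (pre ++ pre′)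
                  (trans ex (trans (cong (pre ++_) ey) (sym (++-assoc pre pre′ _))))) =
    ∷-injectiveˡ (trans (sym (proj₂ (ancestors-head x))) (trans ex (proj₂ (ancestors-head y))))

module _ {n : ℕ} where

  open import Data.List.Membership.DecPropositional (_≟_ {n}) using (_∈?_)

  record FirstCommon (xs ys : List (Fin n)) : Set where
    field
      before  : List (Fin n)
      meet    : Fin n
      after   : List (Fin n)
      xs≡     : xs ≡ before ++ meet ∷ after
      meet∈   : meet ∈ ys
      before∉ : All (_∉ ys) before

  firstCommon : ∀ xs {ys : List (Fin n)} {c} → c ∈ xs → c ∈ ys → FirstCommon xs ys
  firstCommon (x ∷ xs) {ys} c∈xs c∈ys with x ∈? ys | c∈xs
  ... | yes x∈ys | _         = record
    { before = [] ; meet = x ; after = xs ; xs≡ = refl ; meet∈ = x∈ys ; before∉ = [] }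
  ... | no  x∉ys | here refl = contradiction c∈ys x∉ys
  ... | no  x∉ys | there c∈  = record
    { before = x ∷ before ; meet = meet ; after = after
    ; xs≡ = cong (x ∷_) xs≡ ; meet∈ = meet∈ ; before∉ = x∉ys ∷ before∉ }
    where open FirstCommon (firstCommon xs c∈ c∈ys)

  upPart-++ : ∀ pre {m : Fin n} {post ys} → All (_∉ ys) pre → m ∈ ys →
              upPart (pre ++ m ∷ post) ys ≡ pre ++ [ m ]
  upPart-++ []        []          m∈ rewrite ∈⇒elem m∈ = refl
  upPart-++ (b ∷ pre) (b∉ ∷ pre∉) m∈ rewrite ∉⇒elem-false b∉ = cong (b ∷_) (upPart-++ pre pre∉ m∈)

  beforeIn-++ : ∀ pre {m : Fin n} {post ys} → All (_∉ ys) pre → m ∈ ys →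
                beforeIn (pre ++ m ∷ post) ys ≡ pre
  beforeIn-++ []        []          m∈ rewrite ∈⇒elem m∈ = refl
  beforeIn-++ (b ∷ pre) (b∉ ∷ pre∉) m∈ rewrite ∉⇒elem-false b∉ = cong (b ∷_) (beforeIn-++ pre pre∉ m∈)

  module _ {xs ys : List (Fin n)} (F : FirstCommon xs ys) where

    open FirstCommon F

    upPart-first : upPart xs ys ≡ before ++ [ meet ]
    upPart-first = trans (cong (λ zs → upPart zs ys) xs≡) (upPart-++ before before∉ meet∈)

    beforeIn-first : beforeIn xs ys ≡ before
    beforeIn-first = trans (cong (λ zs → beforeIn zs ys) xs≡) (beforeIn-++ before before∉ meet∈)

    meet∈xs : meet ∈ xs
    meet∈xs = subst (meet ∈_) (sym xs≡) (∈-++⁺ʳ before (here refl))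

    common⇒from-meet : ∀ {y} → y ∈ xs → y ∈ ys → y ∈ meet ∷ after
    common⇒from-meet y∈xs y∈ys with ∈-++⁻ before (subst (_ ∈_) xs≡ y∈xs)
    ... | inj₁ y∈before = contradiction y∈ys (All.lookup before∉ y∈before)
    ... | inj₂ y∈rest   = y∈rest

record IsPath {n : ℕ} (T : RootedOrientedTree n) (u z : Fin n) (P : List (Fin n)) : Set where
  field
    linked : Linked (Adjacent T) P
    unique : Unique P
    starts : ∃[ t ] P ≡ u ∷ t
    ends   : ∃[ i ] P ≡ i ++ [ z ]

  start∈ : u ∈ P
  start∈ = subst (u ∈_) (sym (proj₂ starts)) (here refl)

  end∈ : z ∈ P
  end∈ = subst (z ∈_) (sym (proj₂ ends)) (∈-++⁺ʳ _ (here refl))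

module _ {n : ℕ} (T : RootedOrientedTree n) where

  climb-then-descend : ∀ {u z} pre m post pre′ post′ →
    ancestors T u ≡ pre ++ m ∷ post → ancestors T z ≡ pre′ ++ m ∷ post′ → All (_∉ ancestors T u) pre′ →
    IsPath T u z (pre ++ m ∷ reverse pre′)
  climb-then-descend {u} {z} pre m post pre′ post′ eu ez pre′∉ = record
    { linked = Linked-join pre ascent-linked descent-linked
    ; unique = subst Unique (++-assoc pre [ m ] _) (Unique.++⁺ ascent-unique descent-unique disjoint)
    ; starts = let t , e = ++-∷-head pre (trans (sym eu) (proj₂ (ancestors-head T u)))
               in t ++ reverse pre′ , trans (sym (++-assoc pre [ m ] _)) (cong (_++ reverse pre′) e)
    ; ends   = let t , e = ++-∷-head pre′ (trans (sym ez) (proj₂ (ancestors-head T z)))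
               in pre ++ reverse t ,
                  trans (cong (pre ++_) (descent-ends e)) (sym (++-assoc pre (reverse t) [ z ]))
    }
    where
      eu′ : ancestors T u ≡ (pre ++ [ m ]) ++ post
      eu′ = trans eu (sym (++-assoc pre [ m ] post))
      ez′ : ancestors T z ≡ (pre′ ++ [ m ]) ++ post′
      ez′ = trans ez (sym (++-assoc pre′ [ m ] post′))
      ascent-linked : Linked (Adjacent T) (pre ++ [ m ])
      ascent-linked = Linked-++⁻ˡ (pre ++ [ m ]) (subst (Linked (Adjacent T)) eu′ (ancestors-linked T u))
      descent-linked : Linked (Adjacent T) (m ∷ reverse pre′)
      descent-linked =
        subst (Linked (Adjacent T)) (reverse-++ pre′ [ m ]) (Linked-reverse Adjacent-sym
          (Linked-++⁻ˡ (pre′ ++ [ m ]) (subst (Linked (Adjacent T)) ez′ (ancestors-linked T z))))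
      ascent-unique : Unique (pre ++ [ m ])
      ascent-unique = Unique-++⁻ˡ (pre ++ [ m ]) (subst Unique eu′ (ancestors-unique T u))
      descent-unique : Unique (reverse pre′)
      descent-unique = Unique-reverse (Unique-++⁻ˡ pre′ (subst Unique ez (ancestors-unique T z)))
      disjoint : Disjoint (pre ++ [ m ]) (reverse pre′)
      disjoint (y∈ascent , y∈descent) =
        All.lookup pre′∉ (reverse⁻ y∈descent) (subst (_ ∈_) (sym eu′) (∈-++⁺ˡ y∈ascent))
      descent-ends : ∀ {t} → pre′ ++ [ m ] ≡ z ∷ t → m ∷ reverse pre′ ≡ reverse t ++ [ z ]
      descent-ends {t} e = trans (sym (reverse-++ pre′ [ m ])) (trans (cong reverse e) (unfold-reverse z t))

  pathVerts-isPath : ∀ u z → IsPath T u z (pathVerts T (u , z))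
  pathVerts-isPath u z =
    subst (IsPath T u z) (sym pathVerts≡)
      (climb-then-descend F.before F.meet F.after G.before G.after F.xs≡
         (subst (λ m → ancestors T z ≡ G.before ++ m ∷ G.after) (sym same-meet) G.xs≡) G.before∉)
    where
      F : FirstCommon (ancestors T u) (ancestors T z)
      F = firstCommon (ancestors T u) (root∈ancestors T u) (root∈ancestors T z)
      G : FirstCommon (ancestors T z) (ancestors T u)
      G = firstCommon (ancestors T z) (root∈ancestors T z) (root∈ancestors T u)
      module F = FirstCommon F
      module G = FirstCommon G
      same-meet : F.meet ≡ G.meet
      same-meet = ancestors-antisym T
        (subst (G.meet ∈_) (sym (ancestors-suffix T F.before F.xs≡))
               (common⇒from-meet F G.meet∈ (meet∈xs G)))
        (subst (F.meet ∈_) (sym (ancestors-suffix T G.before G.xs≡))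
               (common⇒from-meet G F.meet∈ (meet∈xs F)))
      pathVerts≡ : pathVerts T (u , z) ≡ F.before ++ F.meet ∷ reverse G.before
      pathVerts≡ = trans (cong₂ _++_ (upPart-first F) (cong reverse (beforeIn-first G)))
                         (++-assoc F.before [ F.meet ] _)

module _ {n : ℕ} (T : RootedOrientedTree n) (v : Fin n) where

  open RootedOrientedTree T using () renaming (root to r; parent to p)

  inU-self : inU T v v ≡ true
  inU-self = ∈⇒elem (subst (v ∈_) (sym (proj₂ (ancestors-head T v))) (here refl))

  inU-false⇒≢ : ∀ {a} → inU T v a ≡ false → a ≢ v
  inU-false⇒≢ a∉U refl with () ← trans (sym a∉U) inU-self

  inU-parent : ∀ {a} → a ≢ r → a ≢ v → inU T v a ≡ inU T v (p a)
  inU-parent {a} a≢r a≢v rewrite ancestors-step T a≢r | ≢⇒==-false (a≢v ∘ sym) = refl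

  BoundaryStep : Link n → Set
  BoundaryStep st = st ≡ (v , p v) ⊎ st ≡ (p v , v)

  boundary-step : ∀ {a b} → Adjacent T a b → inU T v a ≢ inU T v b → BoundaryStep (a , b)
  boundary-step (toParent {a} a≢r) a≁b with a ≟ v
  ... | yes refl = inj₁ refl
  ... | no  a≢v  = contradiction (inU-parent a≢r a≢v) a≁b
  boundary-step (fromParent {a} a≢r) a≁b with a ≟ v
  ... | yes refl = inj₂ refl
  ... | no  a≢v  = contradiction (sym (inU-parent a≢r a≢v)) a≁b

  crosses-boundary : ∀ {w x y} → Linked (Adjacent T) w → x ∈ w → y ∈ w → inU T v x ≢ inU T v y →
                     Any BoundaryStep (steps w)
  crosses-boundary lk x∈ y∈ x≁y =
    Any.map (λ (adj , a≁b) → boundary-step adj a≁b) (switching-step (inU T v) lk x∈ y∈ x≁y)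

  crossing-visits-v : ∀ {w x y} → Linked (Adjacent T) w → x ∈ w → y ∈ w → inU T v x ≢ inU T v y → v ∈ w
  crossing-visits-v {w} lk x∈ y∈ x≁y with find (crosses-boundary lk x∈ y∈ x≁y)
  ... | _ , st∈ , inj₁ refl = proj₁ (∈-steps⁻ w st∈)
  ... | _ , st∈ , inj₂ refl = proj₂ (∈-steps⁻ w st∈)

  walk-avoiding-v : ∀ {w x y} → Linked (Adjacent T) w → v ∉ w → x ∈ w → y ∈ w →
                    inU T v x ≡ inU T v y × x ≢ v
  walk-avoiding-v lk v∉ x∈ y∈ =
    decidable-stable (inU T v _ Bool.≟ inU T v _) (v∉ ∘ crossing-visits-v lk x∈ y∈) , λ { refl → v∉ x∈ }

  crossing-segment-visits-v : ∀ {u′ z′} bs → Linked (Adjacent T) (u′ ∷ bs ++ [ z′ ]) → u′ ≢ v → z′ ≢ v →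
                              inU T v u′ ≢ inU T v z′ → v ∈ bs
  crossing-segment-visits-v bs lk u′≢v z′≢v u′≁z′
    with crossing-visits-v lk (here refl) (there (∈-++⁺ʳ bs (here refl))) u′≁z′
  ... | here v≡u′ = contradiction (sym v≡u′) u′≢v
  ... | there v∈ with ∈-++⁻ bs v∈
  ...   | inj₁ v∈bs        = v∈bs
  ...   | inj₂ (here v≡z′) = contradiction (sym v≡z′) z′≢v

  -- v lies strictly between u′ and z′ on the path and occurs on it only once, so the
  -- segments from u to u′ and from z′ to z avoid v.
  path-segment-ends : ∀ {u z P} → IsPath T u z P → ∀ as {u′} bs {z′} cs → P ≡ as ++ u′ ∷ bs ++ z′ ∷ cs →
                      u′ ≢ v → z′ ≢ v → inU T v u′ ≢ inU T v z′ →
                      (inU T v u ≡ inU T v u′ × u ≢ v) × (inU T v z ≡ inU T v z′ × z ≢ v)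
  path-segment-ends {u} {z} {P} path as {u′} bs {z′} cs P≡ u′≢v z′≢v u′≁z′ =
      walk-avoiding-v (Linked-++⁻ˡ (as ++ [ u′ ]) (subst (Linked (Adjacent T)) P≡₁ linked))
                      v∉prefix u∈prefix (∈-++⁺ʳ as (here refl))
    , walk-avoiding-v (Linked-++⁻ʳ (as ++ u′ ∷ bs) (subst (Linked (Adjacent T)) P≡₂ linked))
                      v∉suffix z∈suffix (here refl)
    where
      open IsPath path
      P≡₁ : P ≡ (as ++ [ u′ ]) ++ bs ++ z′ ∷ cs
      P≡₁ = trans P≡ (sym (++-assoc as [ u′ ] _))
      P≡₂ : P ≡ (as ++ u′ ∷ bs) ++ z′ ∷ cs
      P≡₂ = trans P≡ (sym (++-assoc as (u′ ∷ bs) _))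
      P≡₃ : P ≡ as ++ (u′ ∷ bs ++ [ z′ ]) ++ cs
      P≡₃ = trans P≡ (cong (λ ys → as ++ u′ ∷ ys) (sym (++-assoc bs [ z′ ] cs)))
      v∈bs : v ∈ bs
      v∈bs = crossing-segment-visits-v bs
               (Linked-++⁻ˡ (u′ ∷ bs ++ [ z′ ]) (Linked-++⁻ʳ as (subst (Linked (Adjacent T)) P≡₃ linked)))
               u′≢v z′≢v u′≁z′
      v∉prefix : v ∉ as ++ [ u′ ]
      v∉prefix v∈ = Unique-++⇒∉ (as ++ [ u′ ]) (subst Unique P≡₁ unique) v∈ (∈-++⁺ˡ v∈bs)
      v∉suffix : v ∉ z′ ∷ cs
      v∉suffix = Unique-++⇒∉ (as ++ u′ ∷ bs) (subst Unique P≡₂ unique) (∈-++⁺ʳ as (there v∈bs))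
      u∈prefix : u ∈ as ++ [ u′ ]
      u∈prefix = let _ , e = ++-∷-head as (trans (sym P≡) (proj₂ starts)) in
                 subst (u ∈_) (sym e) (here refl)
      z∈suffix : z ∈ z′ ∷ cs
      z∈suffix = ++-∷-last (proj₁ ends) (as ++ u′ ∷ bs) (trans (sym (proj₂ ends)) P≡₂)

  shadow-ends : ∀ {u z u′ z′} → Shadow T (u , z) (u′ , z′) → u′ ≢ v → z′ ≢ v → inU T v u′ ≢ inU T v z′ →
                (inU T v u ≡ inU T v u′ × u ≢ v) × (inU T v z ≡ inU T v z′ × z ≢ v)
  shadow-ends {u} {z} (as , bs , cs , P≡) = path-segment-ends (pathVerts-isPath T u z) as bs cs P≡

  Ldown⁻ : ∀ L {u z} → Ldown T L v (u , z) ≡ true →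
           L (u , z) ≡ true × inU T v z ≡ true × z ≢ v × inU T v u ≡ false
  Ldown⁻ L {u} {z} h with L (u , z) | inU T v z | z ≟ v | inU T v u
  ... | true | true | no z≢v | false = refl , refl , z≢v , refl
  Ldown⁻ L () | false | _     | _     | _
  Ldown⁻ L () | true  | false | _     | _
  Ldown⁻ L () | true  | true  | yes _ | _
  Ldown⁻ L () | true  | true  | no _  | true

  Ldown⁺ : ∀ L {u z} → L (u , z) ≡ true → inU T v z ≡ true → z ≢ v → inU T v u ≡ false →
           Ldown T L v (u , z) ≡ true
  Ldown⁺ L L-uz z∈U z≢v u∉U rewrite L-uz | z∈U | ≢⇒==-false z≢v | u∉U = refl

  Lup⁻ : ∀ L {u z} → Lup T L v (u , z) ≡ true →
         L (u , z) ≡ true × inU T v u ≡ true × u ≢ v × inU T v z ≡ false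
  Lup⁻ L {u} {z} h with L (u , z) | inU T v u | u ≟ v | inU T v z
  ... | true | true | no u≢v | false = refl , refl , u≢v , refl
  Lup⁻ L () | false | _     | _     | _
  Lup⁻ L () | true  | false | _     | _
  Lup⁻ L () | true  | true  | yes _ | _
  Lup⁻ L () | true  | true  | no _  | true

  Lup⁺ : ∀ L {u z} → L (u , z) ≡ true → inU T v u ≡ true → u ≢ v → inU T v z ≡ false →
         Lup T L v (u , z) ≡ true
  Lup⁺ L L-uz u∈U u≢v z∉U rewrite L-uz | u∈U | ≢⇒==-false u≢v | z∉U = refl

  Ldown-shadow-closed : ∀ L ℓ ℓ′ → L ℓ ≡ true → Shadow T ℓ ℓ′ → Ldown T L v ℓ′ ≡ true → Ldown T L v ℓ ≡ true
  Ldown-shadow-closed L (u , z) (u′ , z′) L-uz sh h =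
    let _ , z′∈U , z′≢v , u′∉U = Ldown⁻ L h
        (u~u′ , _) , (z~z′ , z≢v) = shadow-ends sh (inU-false⇒≢ u′∉U) z′≢v (false-true-≢ u′∉U z′∈U)
    in Ldown⁺ L L-uz (trans z~z′ z′∈U) z≢v (trans u~u′ u′∉U)

  Lup-shadow-closed : ∀ L ℓ ℓ′ → L ℓ ≡ true → Shadow T ℓ ℓ′ → Lup T L v ℓ′ ≡ true → Lup T L v ℓ ≡ true
  Lup-shadow-closed L (u , z) (u′ , z′) L-uz sh h =
    let _ , u′∈U , u′≢v , z′∉U = Lup⁻ L h
        (u~u′ , u≢v) , (z~z′ , _) = shadow-ends sh u′≢v (inU-false⇒≢ z′∉U) (false-true-≢ z′∉U u′∈U ∘ sym)
    in Lup⁺ L L-uz (trans u~u′ u′∈U) u≢v (trans z~z′ z′∉U)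

  boundaryArc : Link n
  boundaryArc = if up T v then (v , p v) else (p v , v)

  boundaryArc-isArc : v ≢ r → isArc T boundaryArc ≡ true
  boundaryArc-isArc v≢r with up T v in up-v
  ... | true  rewrite ≢⇒==-false v≢r | ==-refl (p v) | up-v = refl
  ... | false rewrite ≢⇒==-false v≢r | ==-refl (p v) | up-v = Bool.∨-zeroʳ _

  boundaryStep-matches : ∀ {st} → BoundaryStep st →
                         (pairEq st boundaryArc ∨ pairEq st (swap boundaryArc)) ≡ true
  boundaryStep-matches b with up T v | b
  ... | true  | inj₁ refl rewrite pairEq-refl (v , p v) = refl
  ... | true  | inj₂ refl rewrite pairEq-refl (p v , v) = Bool.∨-zeroʳ _
  ... | false | inj₁ refl rewrite pairEq-refl (v , p v) = Bool.∨-zeroʳ _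
  ... | false | inj₂ refl rewrite pairEq-refl (p v , v) = refl

  crossing⇒onPath : ∀ {u z} → inU T v u ≢ inU T v z → onPath T (u , z) boundaryArc ≡ true
  crossing⇒onPath {u} {z} u≁z =
    any-≡true⁺ _ (Any.map boundaryStep-matches (crosses-boundary linked start∈ end∈ u≁z))
    where open IsPath (pathVerts-isPath T u z)

  Ldown-cut : v ≢ r → ∀ L → ShadowClosedCut T L (Ldown T L v)
  Ldown-cut v≢r L = record
    { arc           = boundaryArc
    ; arc-isArc     = boundaryArc-isArc v≢r
    ; ⊆L            = λ (u , z) h → proj₁ (Ldown⁻ L h)
    ; crosses       = λ (u , z) h → let _ , z∈U , _ , u∉U = Ldown⁻ L h in
                                    crossing⇒onPath (false-true-≢ u∉U z∈U)
    ; shadow-closed = Ldown-shadow-closed L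
    }

  Lup-cut : v ≢ r → ∀ L → ShadowClosedCut T L (Lup T L v)
  Lup-cut v≢r L = record
    { arc           = boundaryArc
    ; arc-isArc     = boundaryArc-isArc v≢r
    ; ⊆L            = λ (u , z) h → proj₁ (Lup⁻ L h)
    ; crosses       = λ (u , z) h → let _ , u∈U , _ , z∉U = Lup⁻ L h in
                                    crossing⇒onPath (false-true-≢ z∉U u∈U ∘ sym)
    ; shadow-closed = Lup-shadow-closed L
    }

module _ {n : ℕ} (T : RootedOrientedTree n) {L : Link n → Bool} {σ : Link n → Link n → Bool}
         (spl : IsSplitting T L σ) (v w : Fin n) {L′ : Link n → Bool}
         (σ≡ : ∀ ℓ → L ℓ ≡ true → ∀ ℓ′ → σ ℓ ℓ′ ≡ σsplit T w L′ ℓ ℓ′) where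

  piece∈L : ∀ {ℓ ℓ′} → L ℓ ≡ true → σ ℓ ℓ′ ≡ true → L ℓ′ ≡ true
  piece∈L Lℓ σℓℓ′ = proj₁ (proj₁ (spl _ Lℓ) _ σℓℓ′)

  σsplit-pieces : ∀ {u z} → L (u , z) ≡ true →
                  σ (u , z) (u , z) ≡ true
                  ⊎ (L′ (u , z) ≡ true × σ (u , z) (u , w) ≡ true × σ (u , z) (w , z) ≡ true)
  σsplit-pieces {u} {z} L-uz
    rewrite σ≡ (u , z) L-uz (u , z) | σ≡ (u , z) L-uz (u , w) | σ≡ (u , z) L-uz (w , z)
    with L′ (u , z) | inner T w (u , z)
  ... | false | _     = inj₁ (pairEq-refl (u , z))
  ... | true  | false = inj₁ (pairEq-refl (u , z))
  ... | true  | true  rewrite pairEq-refl (u , w) | pairEq-refl (w , z) =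
    inj₂ (refl , refl , Bool.∨-zeroʳ _)

  split-point≢v : ∀ {D : Link n → Bool} {ℓ} → (w ≢ v ⊎ (∀ ℓ → L′ ℓ ≡ true → D ℓ ≡ false)) →
                  L′ ℓ ≡ true → D ℓ ≡ true → w ≢ v
  split-point≢v (inj₁ w≢v)      _   _  = w≢v
  split-point≢v (inj₂ disjoint) L′ℓ Dℓ with () ← trans (sym (disjoint _ L′ℓ)) Dℓ

  Ldown-pieces : (w ≢ v ⊎ (∀ ℓ → L′ ℓ ≡ true → Ldown T L v ℓ ≡ false)) →
                 ∀ ℓ → Ldown T L v ℓ ≡ true → ∃[ ℓ′ ] σ ℓ ℓ′ ≡ true × Ldown T L v ℓ′ ≡ true
  Ldown-pieces sep (u , z) h with L-uz , z∈U , z≢v , u∉U ← Ldown⁻ T v L h with σsplit-pieces L-uz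
  ... | inj₁ σ-uz = (u , z) , σ-uz , h
  ... | inj₂ (L′-uz , σ-uw , σ-wz) with inU T v w in w∈U
  ...   | true  = (u , w) , σ-uw , Ldown⁺ T v L (piece∈L L-uz σ-uw) w∈U (split-point≢v sep L′-uz h) u∉U
  ...   | false = (w , z) , σ-wz , Ldown⁺ T v L (piece∈L L-uz σ-wz) z∈U z≢v w∈U

  Lup-pieces : (w ≢ v ⊎ (∀ ℓ → L′ ℓ ≡ true → Lup T L v ℓ ≡ false)) →
               ∀ ℓ → Lup T L v ℓ ≡ true → ∃[ ℓ′ ] σ ℓ ℓ′ ≡ true × Lup T L v ℓ′ ≡ true
  Lup-pieces sep (u , z) h with L-uz , u∈U , u≢v , z∉U ← Lup⁻ T v L h with σsplit-pieces L-uz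
  ... | inj₁ σ-uz = (u , z) , σ-uz , h
  ... | inj₂ (L′-uz , σ-uw , σ-wz) with inU T v w in w∈U
  ...   | true  = (w , z) , σ-wz , Lup⁺ T v L (piece∈L L-uz σ-wz) w∈U (split-point≢v sep L′-uz h) z∉U
  ...   | false = (u , w) , σ-uw , Lup⁺ T v L (piece∈L L-uz σ-uw) u∈U u≢v w∈U

proposition8p9 :
    ∀ {n : ℕ} (T : RootedOrientedTree n) (L : Link n → Bool) (c x : Link n → ℚ)
      (σ : Link n → Link n → Bool) (v : Fin n) →
    ShadowComplete T L c → Feasible T L x → IsSplitting T L σ → v ≢ root T →
      ( (xOf (Ldown T L v) (split L x σ) ≤ xOf (Ldown T L v) x)
        × (xOf (Lup T L v) (split L x σ) ≤ xOf (Lup T L v) x) )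
      × (∀ (w : Fin n) (L' : Link n → Bool) →
           (∀ ℓ → L' ℓ ≡ true → L ℓ ≡ true) →
           (w ≢ v ⊎ (∀ ℓ → L' ℓ ≡ true → Ldown T L v ℓ ≡ false)) →
           (∀ ℓ → L ℓ ≡ true → ∀ ℓ' → σ ℓ ℓ' ≡ σsplit T w L' ℓ ℓ') →
           xOf (Ldown T L v) (split L x σ) ≡ xOf (Ldown T L v) x)
      × (∀ (w : Fin n) (L' : Link n → Bool) →
           (∀ ℓ → L' ℓ ≡ true → L ℓ ≡ true) →
           (w ≢ v ⊎ (∀ ℓ → L' ℓ ≡ true → Lup T L v ℓ ≡ false)) →
           (∀ ℓ → L ℓ ≡ true → ∀ ℓ' → σ ℓ ℓ' ≡ σsplit T w L' ℓ ℓ') →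
           xOf (Lup T L v) (split L x σ) ≡ xOf (Lup T L v) x)
proposition8p9 T L c x σ v _ (x≥0 , _) spl v≢r =
    (Down.split-mass-≤ x≥0 , Up.split-mass-≤ x≥0)
  , (λ w _ _ sep σ≡ → Down.split-mass-≡ (Ldown-pieces T spl v w σ≡ sep))
  , (λ w _ _ sep σ≡ → Up.split-mass-≡ (Lup-pieces T spl v w σ≡ sep))
  where
    module Down = SplitMass spl (Ldown-cut T v v≢r L) x
    module Up   = SplitMass spl (Lup-cut T v v≢r L) x
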